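{- Let $z\neq 2$ be a positive integer and let $p$ be the smallest prime number such that $4z+1\le p\le 5z$. Then $n[z,r;5]\le 2pr$ for every $r\in\{1,\ldots,p\}$.
   Context: A mixed graph is a finite simple graph that may contain both (undirected) edges and (directed) arcs, with no multiple edges or arcs. It is $z$-regular by arcs and $r$-regular by edges if every vertex is the head of exactly $z$ arcs, the tail of exactly $z$ arcs, and is incident with exactly $r$ edges. Cycles are sequences of vertices where consecutive vertices are joined by an edge or by an arc traversed in its direction; the girth is the length of a shortest cycle. A $[z,r;g]$-mixed graph is a mixed graph that is $z$-regular by arcs, $r$-regular by edges and has girth $g$; a $[z,r;g]$-mixed cage is one of minimum order, and $n[z,r;g]$ denotes the order of a $[z,r;g]$-mixed cage. -}

module Defs where

open import Data.Nat using (ℕ; zero; suc; _+_; _*_; _≤_; _<_)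
open import Data.Nat.Primality using (Prime)
open import Data.Fin using (Fin)
open import Data.Bool using (Bool; true; false; if_then_else_)
open import Data.Sum using (_⊎_)
open import Data.Product using (Σ; _×_; ∃-syntax)
open import Relation.Binary.PropositionalEquality using (_≡_)

-- E u v = true : there is an (undirected) edge {u,v};
-- A u v = true : there is an arc from u (tail) to v (head).
-- Using Bool-valued relations means there are no multiple edges or arcs;
-- no loops; a pair of vertices is not joined by both an edge and an arc.
record MixedGraph (n : ℕ) : Set where
  field
    E        : Fin n → Fin n → Bool
    A        : Fin n → Fin n → Bool
    E-irrefl : ∀ u → E u u ≡ false
    E-sym    : ∀ u v → E u v ≡ E v u
    A-irrefl : ∀ u → A u u ≡ false
    EA-disj  : ∀ u v → E u v ≡ true → A u v ≡ false

open MixedGraph public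

countTrue : ∀ {n} → (Fin n → Bool) → ℕ
countTrue {zero}  f = 0
countTrue {suc n} f = (if f Fin.zero then 1 else 0) + countTrue (λ i → f (Fin.suc i))

Step : ∀ {n} → MixedGraph n → Fin n → Fin n → Set
Step G u v = (E G u v ≡ true) ⊎ (A G u v ≡ true)

-- For k = 2 the two steps cannot be the same edge traversed twice,
-- so at least one of them is an arc.
record Cycle {n : ℕ} (G : MixedGraph n) (k : ℕ) : Set where
  field
    vtx      : ℕ → Fin n
    len≥2    : 2 ≤ k
    closed   : vtx k ≡ vtx 0
    steps    : ∀ i → i < k → Step G (vtx i) (vtx (suc i))
    distinct : ∀ i j → i < k → j < k → vtx i ≡ vtx j → i ≡ j
    not-edge-twice : k ≡ 2 → (A G (vtx 0) (vtx 1) ≡ true) ⊎ (A G (vtx 1) (vtx 0) ≡ true)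

HasGirth : ∀ {n} → MixedGraph n → ℕ → Set
HasGirth G g = Cycle G g × (∀ k → Cycle G k → g ≤ k)

IsMixedGraph : ∀ {n} → MixedGraph n → ℕ → ℕ → ℕ → Set
IsMixedGraph {n} G z r g =
  (∀ v → countTrue (λ u → A G u v) ≡ z) ×
  (∀ v → countTrue (λ u → A G v u) ≡ z) ×
  (∀ v → countTrue (λ u → E G v u) ≡ r) ×
  HasGirth G g

-- n[z,r;g] ≤ N : the minimum order of a [z,r;g]-mixed graph is at most N,
-- i.e. some [z,r;g]-mixed graph has order at most N.
CageOrder≤ : ℕ → ℕ → ℕ → ℕ → Set
CageOrder≤ z r g N = ∃[ n ] (n ≤ N × Σ (MixedGraph n) (λ G → IsMixedGraph G z r g))

SmallestPrimeIn : ℕ → ℕ → ℕ → Set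
SmallestPrimeIn a b p =
  Prime p × a ≤ p × p ≤ b × (∀ q → Prime q → a ≤ q → q ≤ b → p ≤ q)

-- The graph is the incidence graph of a partial affine plane over ℤ_p with
-- circulant arcs added inside its columns.  Its vertices are the points (x, y)
-- with abscissa x < r and the lines y = m x + b with slope m < r; a point has one
-- line of each slope through it and a line has one point of each abscissa on it,
-- so there are 2pr vertices, each on r edges.  In every column (the points with a
-- fixed x, or the lines with a fixed m) there is an arc from height h to h + s for
-- each 1 ≤ s ≤ z, giving z arcs in and z arcs out.
--
-- Adding a constant to all heights preserves incidence, and arcs stay inside a
-- column.  Edges join points to lines while arcs do not, so a closed walk of
-- length at most 4 uses 0, 2 or 4 edges.  The arcs of a walk without edges rise
-- in total by between 1 and 4z < p, which is not 0 mod p.  If two of its edges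
-- meet at a vertex v, the arcs join two neighbours of v in one column; v has only
-- one neighbour per column, so these arcs close up with a nonzero rise.  If two
-- edges are opposite, sliding one along the arcs lands on the other and the arcs
-- again close up.  Four edges form a quadrangle of the plane, which is degenerate
-- because (m₁ − m₂)(x₁ − x₂) ≡ 0 mod p forces m₁ = m₂ or x₁ = x₂.  Finally the
-- heights 0, z, 2z, 3z, 4z of one column form a directed 5-cycle: the step from
-- 4z back to 0 has length p − 4z ≤ z.

module Submission where

open import Defs
open import Data.Bool using (Bool; true; false; if_then_else_)
open import Data.Bool.Properties using (¬-not)
open import Data.Empty using (⊥; ⊥-elim)
open import Data.Fin using (Fin; zero; suc; toℕ; fromℕ<)
open import Data.Fin.Properties using (_≟_; suc-injective; ¬Fin0; 0≢1+n; toℕ-fromℕ<; toℕ-injective; toℕ<n)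
open import Data.Nat as ℕ using (ℕ; zero; suc; _≤_; _<_; z≤n; s≤s; NonZero)
import Data.Nat.Properties as ℕ
open import Data.Nat.Primality using (Prime)
open import Data.Product using (∃; _,_; proj₁; proj₂)
open import Data.Sum using (_⊎_; inj₁; inj₂)
open import Function using (_∘_; _↔_; Inverse; mk⇔)
open import Level using (0ℓ)
open import Relation.Nullary using (Dec; yes; no; does; ¬_)
open import Relation.Nullary.Decidable using (dec-true; dec-false; does-⇔; True; toWitness)
open import Relation.Binary.PropositionalEquality

erase : ∀ {n} → Fin n → (Fin n → Bool) → Fin n → Bool
erase u₀ f u = if does (u ≟ u₀) then false else f u

countTrue-erase : ∀ {n} (f : Fin n → Bool) u₀ → f u₀ ≡ true → countTrue f ≡ suc (countTrue (erase u₀ f))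
countTrue-erase f zero fu₀≡true rewrite fu₀≡true = refl
countTrue-erase f (suc u₀) fu₀≡true =
  trans (cong (head ℕ.+_) (countTrue-erase (f ∘ suc) u₀ fu₀≡true)) (ℕ.+-suc head _)
  where head = if f zero then 1 else 0

countTrue-false : ∀ {n} (f : Fin n → Bool) → (∀ u → f u ≡ false) → countTrue f ≡ 0
countTrue-false {zero}  f f≡false = refl
countTrue-false {suc n} f f≡false rewrite f≡false zero = countTrue-false (f ∘ suc) (f≡false ∘ suc)

countTrue-image : ∀ {n k} (f : Fin n → Bool) (g : Fin k → Fin n) → (∀ {i j} → g i ≡ g j → i ≡ j) →
  (∀ u → f u ≡ true → ∃ λ i → u ≡ g i) → (∀ i → f (g i) ≡ true) → countTrue f ≡ k
countTrue-image {k = zero} f g _ only-image _ =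
  countTrue-false f (λ u → ¬-not (¬Fin0 ∘ proj₁ ∘ only-image u))
countTrue-image {k = suc k} f g g-injective only-image on-image =
  trans (countTrue-erase f (g zero) (on-image zero))
        (cong suc (countTrue-image (erase (g zero) f) (g ∘ suc) (suc-injective ∘ g-injective) only-rest on-rest))
  where
  only-rest : ∀ u → erase (g zero) f u ≡ true → ∃ λ i → u ≡ g (suc i)
  only-rest u erased with u ≟ g zero
  only-rest u () | yes _
  ... | no u≢g0 with only-image u erased
  ...   | zero  , u≡g0 = ⊥-elim (u≢g0 u≡g0)
  ...   | suc i , u≡gi = i , u≡gi
  on-rest : ∀ i → erase (g zero) f (g (suc i)) ≡ true
  on-rest i with g (suc i) ≟ g zero
  ... | yes gi≡g0 = ⊥-elim (0≢1+n (sym (g-injective gi≡g0)))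
  ... | no _ = on-image (suc i)

record Enumeration {A : Set} (P : A → Set) (k : ℕ) : Set where
  field
    element   : Fin k → A
    injective : ∀ {i j} → element i ≡ element j → i ≡ j
    sound     : ∀ i → P (element i)
    complete  : ∀ {a} → P a → ∃ λ i → a ≡ element i

from-does-true : ∀ {A : Set} (a? : Dec A) → does a? ≡ true → A
from-does-true (yes a) _ = a

module Realisation {V : Set} {N : ℕ} (vertices : Fin N ↔ V)
  {Edge Arc : V → V → Set}
  (edge? : ∀ a b → Dec (Edge a b)) (arc? : ∀ a b → Dec (Arc a b))
  (edge-sym : ∀ {a b} → Edge a b → Edge b a) (edge-irrefl : ∀ {a} → ¬ Edge a a)
  (arc-irrefl : ∀ {a} → ¬ Arc a a) (edge⇒¬arc : ∀ {a b} → Edge a b → ¬ Arc a b)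
  where

  open Inverse vertices using (to; from; strictlyInverseˡ; strictlyInverseʳ)

  graph : MixedGraph N
  graph = record
    { E        = λ u v → does (edge? (to u) (to v))
    ; A        = λ u v → does (arc? (to u) (to v))
    ; E-irrefl = λ _ → dec-false (edge? _ _) edge-irrefl
    ; E-sym    = λ _ _ → does-⇔ (mk⇔ edge-sym edge-sym) (edge? _ _) (edge? _ _)
    ; A-irrefl = λ _ → dec-false (arc? _ _) arc-irrefl
    ; EA-disj  = λ _ _ e → dec-false (arc? _ _) (edge⇒¬arc (from-does-true (edge? _ _) e))
    }

  from-injective : ∀ {a b} → from a ≡ from b → a ≡ b
  from-injective {a} {b} eq = trans (sym (strictlyInverseˡ a)) (trans (cong to eq) (strictlyInverseˡ b))

  to-injective : ∀ {u v} → to u ≡ to v → u ≡ v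
  to-injective {u} {v} eq = trans (sym (strictlyInverseʳ u)) (trans (cong from eq) (strictlyInverseʳ v))

  countTrue-enumeration : ∀ {P : V → Set} {k} (P? : ∀ a → Dec (P a)) → Enumeration P k →
    countTrue (λ u → does (P? (to u))) ≡ k
  countTrue-enumeration {P} P? enum =
    countTrue-image _ (from ∘ element) (injective ∘ from-injective) only-elements elements
    where
    open Enumeration enum
    only-elements : ∀ u → does (P? (to u)) ≡ true → ∃ λ i → u ≡ from (element i)
    only-elements u P⟦u⟧ with complete (from-does-true (P? (to u)) P⟦u⟧)
    ... | i , ⟦u⟧≡element = i , trans (sym (strictlyInverseʳ u)) (cong from ⟦u⟧≡element)
    elements : ∀ i → does (P? (to (from (element i)))) ≡ true
    elements i = dec-true (P? _) (subst P (sym (strictlyInverseˡ (element i))) (sound i))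

  is-mixed-graph : ∀ {z r g} → (∀ b → Enumeration (λ a → Arc a b) z) → (∀ a → Enumeration (Arc a) z) →
    (∀ a → Enumeration (Edge a) r) → HasGirth graph g → IsMixedGraph graph z r g
  is-mixed-graph arcs-into arcs-out-of edges-at girth =
      (λ v → countTrue-enumeration (λ a → arc? a (to v)) (arcs-into (to v)))
    , (λ u → countTrue-enumeration (arc? (to u)) (arcs-out-of (to u)))
    , (λ u → countTrue-enumeration (edge? (to u)) (edges-at (to u)))
    , girth

  Link : V → V → Set
  Link a b = Edge a b ⊎ Arc a b

  step⇒link : ∀ {u v} → Step graph u v → Link (to u) (to v)
  step⇒link (inj₁ edge) = inj₁ (from-does-true (edge? _ _) edge)
  step⇒link (inj₂ arc)  = inj₂ (from-does-true (arc? _ _) arc)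

  arc⇒A : ∀ {a b} → Arc a b → A graph (from a) (from b) ≡ true
  arc⇒A {a} {b} arc = dec-true (arc? _ _) (subst₂ Arc (sym (strictlyInverseˡ a)) (sym (strictlyInverseˡ b)) arc)

  arc-cycle : ∀ {k} (w : ℕ → V) → 2 ≤ k → w k ≡ w 0 → (∀ i → i < k → Arc (w i) (w (suc i))) →
    (∀ i j → i < k → j < k → w i ≡ w j → i ≡ j) → Cycle graph k
  arc-cycle w 2≤k closed arcs distinct = record
    { vtx            = from ∘ w
    ; len≥2          = 2≤k
    ; closed         = cong from closed
    ; steps          = λ i i<k → inj₂ (arc⇒A (arcs i i<k))
    ; distinct       = λ i j i<k j<k eq → distinct i j i<k j<k (from-injective eq)
    ; not-edge-twice = λ { refl → inj₁ (arc⇒A (arcs 0 (s≤s z≤n))) }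
    }

  module _ {k} (cycle : Cycle graph k) where
    open Cycle cycle

    link : ∀ i {i<k : True (suc i ℕ.≤? k)} → Link (to (vtx i)) (to (vtx (suc i)))
    link i {i<k} = step⇒link (steps i (toWitness i<k))

    closing-link : ∀ i → suc i ≡ k → Link (to (vtx i)) (to (vtx 0))
    closing-link i refl = subst (Link (to (vtx i)) ∘ to) closed (step⇒link (steps i ℕ.≤-refl))

    distinct-vertices : ∀ i j {i<k : True (suc i ℕ.≤? k)} {j<k : True (suc j ℕ.≤? k)} →
      to (vtx i) ≡ to (vtx j) → i ≡ j
    distinct-vertices i j {i<k} {j<k} eq = distinct i j (toWitness i<k) (toWitness j<k) (to-injective eq)

  module _ (no-digon : ∀ {a b} → Arc a b → ¬ Link b a)
           (no-triangle : ∀ {a b c} → Link a b → Link b c → ¬ Link c a)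
           (quadrangle-degenerate : ∀ {a b c d} → Link a b → Link b c → Link c d → Link d a → a ≡ c ⊎ b ≡ d)
    where

    private
      no-short-cycle : ∀ {k} → Cycle graph k → ¬ k < 5
      no-short-cycle {2} cycle _ with Cycle.not-edge-twice cycle refl
      ... | inj₁ arc₀₁ = no-digon (from-does-true (arc? _ _) arc₀₁) (closing-link cycle 1 refl)
      ... | inj₂ arc₁₀ = no-digon (from-does-true (arc? _ _) arc₁₀) (link cycle 0)
      no-short-cycle {3} cycle _ = no-triangle (link cycle 0) (link cycle 1) (closing-link cycle 2 refl)
      no-short-cycle {4} cycle _
        with quadrangle-degenerate (link cycle 0) (link cycle 1) (link cycle 2) (closing-link cycle 3 refl)
      ... | inj₁ v₀≡v₂ with distinct-vertices cycle 0 2 v₀≡v₂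
      ...   | ()
      no-short-cycle {4} cycle _ | inj₂ v₁≡v₃ with distinct-vertices cycle 1 3 v₁≡v₃
      ...   | ()
      no-short-cycle {0} cycle _ with Cycle.len≥2 cycle
      ... | ()
      no-short-cycle {1} cycle _ with Cycle.len≥2 cycle
      ... | s≤s ()
      no-short-cycle {suc (suc (suc (suc (suc _))))} cycle (s≤s (s≤s (s≤s (s≤s (s≤s ())))))

    cycle-length≥5 : ∀ {k} → Cycle graph k → 5 ≤ k
    cycle-length≥5 = ℕ.≮⇒≥ ∘ no-short-cycle

module Congruence (p : ℕ) where

  open import Data.Integer using (ℤ; +_; 0ℤ; _+_; _-_; _*_; -_; ∣_∣)
  open import Data.Integer.DivMod using (_%ℕ_; _/ℕ_; n%ℕd<d; a≡a%ℕn+[a/ℕn]*n)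
  open import Data.Integer.Divisibility.Signed
    using (_∣_; _∣?_; divides; ∣m∣n⇒∣m+n; ∣m⇒∣-m; ∣m∣n⇒∣m-n; ∣⇒∣ᵤ; ∣ᵤ⇒∣)
  open import Data.Integer.Properties using (m-n≡m⊖n; ∣m⊝n∣≤m⊔n; ∣i∣≡0⇒i≡0; i-j≡0⇒i≡j; +-injective; abs-*)
  open import Data.Integer.Tactic.RingSolver using (solve-∀; solve)
  open import Data.List using (_∷_; [])
  open import Data.Nat.Divisibility as ℕ using (>⇒∤)
  open import Data.Nat.Primality using (euclidsLemma)
  open import Relation.Binary.Bundles using (Setoid)
  open import Relation.Nullary.Decidable using (map′)
  import Data.Sum as Sum

  -- A record, not a synonym for + p ∣ a - b, so that a and b can be inferred from a ≈ b.
  infix 4 _≈_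
  record _≈_ (a b : ℤ) : Set where
    constructor congruent
    field p∣a-b : + p ∣ a - b
  open _≈_ public

  private
    divides-by : ∀ {a b} → + p ∣ a → a ≡ b → + p ∣ b
    divides-by p∣a refl = p∣a

    congruent-by : ∀ {a b d} → + p ∣ d → d ≡ a - b → a ≈ b
    congruent-by p∣d refl = congruent p∣d

  ≈-reflexive : ∀ {a b} → a ≡ b → a ≈ b
  ≈-reflexive {a} refl = congruent (divides 0ℤ (identity a))
    where identity : ∀ a → a - a ≡ 0ℤ * + p
          identity = solve-∀

  ≈-sym : ∀ {a b} → a ≈ b → b ≈ a
  ≈-sym {a} {b} (congruent p∣a-b) = congruent-by (∣m⇒∣-m p∣a-b) (identity a b)
    where identity : ∀ a b → - (a - b) ≡ b - a
          identity = solve-∀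

  ≈-trans : ∀ {a b c} → a ≈ b → b ≈ c → a ≈ c
  ≈-trans {a} {b} {c} (congruent p∣a-b) (congruent p∣b-c) = congruent-by (∣m∣n⇒∣m+n p∣a-b p∣b-c) (identity a b c)
    where identity : ∀ a b c → (a - b) + (b - c) ≡ a - c
          identity = solve-∀

  ≈-setoid : Setoid 0ℓ 0ℓ
  ≈-setoid = record
    { Carrier = ℤ ; _≈_ = _≈_
    ; isEquivalence = record { refl = ≈-reflexive refl ; sym = ≈-sym ; trans = ≈-trans } }

  +-congˡ : ∀ a {b c} → b ≈ c → a + b ≈ a + c
  +-congˡ a {b} {c} (congruent p∣b-c) = congruent-by p∣b-c (identity a b c)
    where identity : ∀ a b c → b - c ≡ (a + b) - (a + c)
          identity = solve-∀

  +-congʳ : ∀ {a b} c → a ≈ b → a + c ≈ b + c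
  +-congʳ {a} {b} c (congruent p∣a-b) = congruent-by p∣a-b (identity a b c)
    where identity : ∀ a b c → a - b ≡ (a + c) - (b + c)
          identity = solve-∀

  +-cancelˡ : ∀ a {b c} → a + b ≈ a + c → b ≈ c
  +-cancelˡ a {b} {c} (congruent p∣a+b-a+c) = congruent-by p∣a+b-a+c (identity a b c)
    where identity : ∀ a b c → (a + b) - (a + c) ≡ b - c
          identity = solve-∀

  p≈0 : + p ≈ 0ℤ
  p≈0 = congruent (divides (+ 1) (identity (+ p)))
    where identity : ∀ p → p - 0ℤ ≡ + 1 * p
          identity = solve-∀

  infix 4 _≈?_
  _≈?_ : ∀ a b → Dec (a ≈ b)
  a ≈? b = map′ congruent p∣a-b (+ p ∣? a - b)

  neg-cancel : ∀ {a b} → - a ≈ - b → a ≈ b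
  neg-cancel {a} {b} (congruent p∣-a+b) = congruent-by (∣m⇒∣-m p∣-a+b) (identity a b)
    where identity : ∀ a b → - (- a - - b) ≡ a - b
          identity = solve-∀

  small-≈⇒≡ : ∀ {m n} → m < p → n < p → + m ≈ + n → m ≡ n
  small-≈⇒≡ {m} {n} m<p n<p m≈n = +-injective (i-j≡0⇒i≡j _ _ (∣i∣≡0⇒i≡0 small-multiple))
    where
    multiple-below-p : ∀ {k} → p ℕ.∣ k → k < p → k ≡ 0
    multiple-below-p {zero}  _   _   = refl
    multiple-below-p {suc k} p∣k k<p = ⊥-elim (>⇒∤ k<p p∣k)
    small-multiple : ∣ + m - + n ∣ ≡ 0
    small-multiple = multiple-below-p (∣⇒∣ᵤ (p∣a-b m≈n))
      (subst (λ d → ∣ d ∣ < p) (sym (m-n≡m⊖n m n)) (ℕ.≤-<-trans (∣m⊝n∣≤m⊔n m n) (ℕ.⊔-pres-<m m<p n<p)))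

  prime-∣-* : Prime p → ∀ {a b} → + p ∣ a * b → (+ p ∣ a) ⊎ (+ p ∣ b)
  prime-∣-* p-prime {a} {b} p∣ab =
    Sum.map ∣ᵤ⇒∣ ∣ᵤ⇒∣ (euclidsLemma ∣ a ∣ ∣ b ∣ p-prime (subst (p ℕ.∣_) (abs-* a b) (∣⇒∣ᵤ p∣ab)))

  incidence-quadrangle : Prime p → ∀ {y₁ y₂ x₁ x₂ b₁ b₂ m₁ m₂} →
    y₁ ≈ m₁ * x₁ + b₁ → y₂ ≈ m₁ * x₂ + b₁ → y₁ ≈ m₂ * x₁ + b₂ → y₂ ≈ m₂ * x₂ + b₂ → m₁ ≈ m₂ ⊎ x₁ ≈ x₂
  incidence-quadrangle p-prime {y₁} {y₂} {x₁} {x₂} {b₁} {b₂} {m₁} {m₂}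
    (congruent e₁₁) (congruent e₂₁) (congruent e₁₂) (congruent e₂₂) =
    Sum.map congruent congruent
      (prime-∣-* p-prime (divides-by (∣m⇒∣-m (∣m∣n⇒∣m+n (∣m∣n⇒∣m-n (∣m∣n⇒∣m-n e₁₁ e₂₁) e₁₂) e₂₂)) identity))
    where
    identity : - ((((y₁ - (m₁ * x₁ + b₁)) - (y₂ - (m₁ * x₂ + b₁))) - (y₁ - (m₂ * x₁ + b₂))) + (y₂ - (m₂ * x₂ + b₂)))
               ≡ (m₁ - m₂) * (x₁ - x₂)
    identity = solve (y₁ ∷ y₂ ∷ x₁ ∷ x₂ ∷ b₁ ∷ b₂ ∷ m₁ ∷ m₂ ∷ [])

  module _ {{_ : NonZero p}} where

    fin-≈⇒≡ : ∀ {u v : Fin p} → + toℕ u ≈ + toℕ v → u ≡ v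
    fin-≈⇒≡ {u} {v} u≈v = toℕ-injective (small-≈⇒≡ (toℕ<n u) (toℕ<n v) u≈v)

    residue : ℤ → Fin p
    residue a = fromℕ< (n%ℕd<d a p)

    residue-≈ : ∀ a → + toℕ (residue a) ≈ a
    residue-≈ a rewrite toℕ-fromℕ< (n%ℕd<d a p) =
      congruent (divides (- (a /ℕ p)) (identity (+ (a %ℕ p)) (a /ℕ p) (+ p) a (a≡a%ℕn+[a/ℕn]*n a p)))
      where identity : ∀ r q d a → a ≡ r + q * d → r - a ≡ - q * d
            identity r q d a refl = solve (r ∷ q ∷ d ∷ [])

    residue-unique : ∀ {u a} → + toℕ u ≈ a → u ≡ residue a
    residue-unique {u} {a} u≈a = fin-≈⇒≡ (≈-trans u≈a (≈-sym (residue-≈ a)))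

module PartialPlane (p z r : ℕ) (p-prime : Prime p) (4z<p : 4 ℕ.* z < p) (r≤p : r ≤ p) where

  open import Data.Bool as Bool using (_xor_)
  open import Data.Bool.Properties using (xor-assoc)
  open import Data.Fin.Properties using (any?; 2↔Bool; *↔×)
  open import Data.Integer using (ℤ; +_; 0ℤ; _+_; _-_; _*_; -_)
  open import Data.Integer.Properties using (pos-+; neg-involutive; +-identityʳ; +-assoc)
  open import Data.Integer.Tactic.RingSolver using (solve-∀)
  open import Data.Nat.DivMod using (_%_; m%n<n; m<n⇒m%n≡m)
  open import Data.Nat.Primality using (prime⇒nonZero)
  open import Data.Product using (Σ; _×_)
  open import Data.Product.Algebra using (×-assoc)
  open import Data.Product.Function.NonDependent.Propositional using (_×-↔_)
  import Data.Sum as Sum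
  open import Function.Construct.Composition using (_↔-∘_)
  open import Function.Construct.Identity using (↔-id)

  instance
    p≢0 : NonZero p
    p≢0 = prime⇒nonZero p-prime

  open Congruence p
  open import Relation.Binary.Reasoning.Setoid ≈-setoid

  ⟦_⟧ : ∀ {n} → Fin n → ℤ
  ⟦ u ⟧ = + toℕ u

  Vertex : Set
  Vertex = Bool × Fin p × Fin r

  -- point y x is the point (x, y) and line b m the line y = m x + b.
  pattern point y x = false , y , x
  pattern line b m = true , b , m

  vertices : Fin (2 ℕ.* p ℕ.* r) ↔ Vertex
  vertices = ×-assoc 0ℓ Bool (Fin p) (Fin r)
         ↔-∘ (((2↔Bool ×-↔ ↔-id _) ×-↔ ↔-id _) ↔-∘ ((*↔× ×-↔ ↔-id _) ↔-∘ *↔×))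

  side : Vertex → Bool
  side = proj₁

  column : Vertex → Fin r
  column = proj₂ ∘ proj₂

  Incident : Fin p → Fin r → Fin p → Fin r → Set
  Incident y x b m = ⟦ y ⟧ ≈ ⟦ m ⟧ * ⟦ x ⟧ + ⟦ b ⟧

  Edge : Vertex → Vertex → Set
  Edge (point y x) (line b m)   = Incident y x b m
  Edge (line b m)  (point y x)  = Incident y x b m
  Edge (point _ _) (point _ _)  = ⊥
  Edge (line _ _)  (line _ _)   = ⊥

  data Shift (d : ℤ) : Vertex → Vertex → Set where
    shift : ∀ {s h h′ c} → ⟦ h′ ⟧ ≈ ⟦ h ⟧ + d → Shift d (s , h , c) (s , h′ , c)

  arc-length : Fin z → ℕ
  arc-length i = suc (toℕ i)

  Arc : Vertex → Vertex → Set
  Arc a b = Σ (Fin z) λ i → Shift (+ arc-length i) a b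

  edge? : ∀ a b → Dec (Edge a b)
  edge? (point y x) (line b m)  = _ ≈? _
  edge? (line b m)  (point y x) = _ ≈? _
  edge? (point _ _) (point _ _) = no λ ()
  edge? (line _ _)  (line _ _)  = no λ ()

  shift? : ∀ d a b → Dec (Shift d a b)
  shift? d (s , h , c) (s′ , h′ , c′) with s Bool.≟ s′ | c ≟ c′ | ⟦ h′ ⟧ ≈? ⟦ h ⟧ + d
  ... | yes refl | yes refl | yes h′≈ = yes (shift h′≈)
  ... | no s≢s′  | _        | _       = no λ { (shift _) → s≢s′ refl }
  ... | yes _    | no c≢c′  | _       = no λ { (shift _) → c≢c′ refl }
  ... | yes _    | yes _    | no h′≉  = no λ { (shift h′≈) → h′≉ h′≈ }

  arc? : ∀ a b → Dec (Arc a b)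
  arc? a b = any? λ i → shift? (+ arc-length i) a b

  edge-sym : ∀ {a b} → Edge a b → Edge b a
  edge-sym {point _ _} {line _ _} e = e
  edge-sym {line _ _} {point _ _} e = e

  edge-irrefl : ∀ {a} → ¬ Edge a a
  edge-irrefl {point _ _} ()
  edge-irrefl {line _ _} ()

  edge⇒¬shift : ∀ {a b d} → Edge a b → ¬ Shift d a b
  edge⇒¬shift {point _ _} {line _ _} _ ()
  edge⇒¬shift {line _ _} {point _ _} _ ()

  shift-trans : ∀ {a b c m n} → Shift (+ m) a b → Shift (+ n) b c → Shift (+ (m ℕ.+ n)) a c
  shift-trans {_ , h , _} {_ , h′ , _} {_ , h″ , _} {m} {n} (shift h′≈) (shift h″≈) = shift (begin
      ⟦ h″ ⟧                 ≈⟨ h″≈ ⟩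
      ⟦ h′ ⟧ + + n           ≈⟨ +-congʳ (+ n) h′≈ ⟩
      (⟦ h ⟧ + + m) + + n    ≡⟨ +-assoc ⟦ h ⟧ (+ m) (+ n) ⟩
      ⟦ h ⟧ + (+ m + + n)    ≡⟨ cong (λ e → ⟦ h ⟧ + e) (pos-+ m n) ⟨
      ⟦ h ⟧ + + (m ℕ.+ n)    ∎)

  shift-irrefl : ∀ {a n} → 0 < n → n < p → ¬ Shift (+ n) a a
  shift-irrefl {_ , h , _} {n} 0<n n<p (shift h≈h+n) = ℕ.<⇒≢ 0<n (small-≈⇒≡ (ℕ.≤-<-trans z≤n n<p) n<p 0≈n)
    where
    0≈n : + 0 ≈ + n
    0≈n = +-cancelˡ ⟦ h ⟧ (≈-trans (≈-reflexive (+-identityʳ ⟦ h ⟧)) h≈h+n)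

  z<p : z < p
  z<p = ℕ.≤-<-trans (ℕ.m≤m+n z _) 4z<p

  arc-length<p : ∀ i → arc-length i < p
  arc-length<p i = ℕ.≤-<-trans (toℕ<n i) z<p

  arc-length-injective : ∀ {i j} → + arc-length i ≈ + arc-length j → i ≡ j
  arc-length-injective {i} {j} i≈j = toℕ-injective (ℕ.suc-injective (small-≈⇒≡ (arc-length<p i) (arc-length<p j) i≈j))

  arc-irrefl : ∀ {a} → ¬ Arc a a
  arc-irrefl (i , a↝a) = shift-irrefl (s≤s z≤n) (arc-length<p i) a↝a

  edge⇒¬arc : ∀ {a b} → Edge a b → ¬ Arc a b
  edge⇒¬arc edge (_ , a↝b) = edge⇒¬shift edge a↝b

  shifted : ℤ → Vertex → Vertex
  shifted d (s , h , c) = s , residue (⟦ h ⟧ + d) , c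

  shift-shifted : ∀ d a → Shift d a (shifted d a)
  shift-shifted d (_ , h , _) = shift (residue-≈ (⟦ h ⟧ + d))

  shift⇒≡shifted : ∀ {d a b} → Shift d a b → b ≡ shifted d a
  shift⇒≡shifted (shift h′≈) = cong (λ h′ → _ , h′ , _) (residue-unique h′≈)

  shifted-injective : ∀ a d e → shifted d a ≡ shifted e a → d ≈ e
  shifted-injective (_ , h , _) d e eq = +-cancelˡ ⟦ h ⟧ (begin
    ⟦ h ⟧ + d                          ≈⟨ residue-≈ (⟦ h ⟧ + d) ⟨
    ⟦ residue (⟦ h ⟧ + d) ⟧            ≡⟨ cong (⟦_⟧ ∘ proj₁ ∘ proj₂) eq ⟩
    ⟦ residue (⟦ h ⟧ + e) ⟧            ≈⟨ residue-≈ (⟦ h ⟧ + e) ⟩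
    ⟦ h ⟧ + e                          ∎)

  shift-flip : ∀ {d a b} → Shift d a b → Shift (- d) b a
  shift-flip {d} {_ , h , _} {_ , h′ , _} (shift h′≈) = shift (begin
    ⟦ h ⟧                  ≡⟨ identity ⟦ h ⟧ d ⟩
    (⟦ h ⟧ + d) + - d      ≈⟨ +-congʳ (- d) h′≈ ⟨
    ⟦ h′ ⟧ + - d           ∎)
    where identity : ∀ h d → h ≡ (h + d) + - d
          identity = solve-∀

  arcs-out-of : ∀ a → Enumeration (Arc a) z
  arcs-out-of a = record
    { element   = λ i → shifted (+ arc-length i) a
    ; injective = λ {i} {j} → arc-length-injective ∘ shifted-injective a (+ arc-length i) (+ arc-length j)
    ; sound     = λ i → i , shift-shifted (+ arc-length i) a
    ; complete  = λ (i , a↝b) → i , shift⇒≡shifted a↝b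
    }

  arcs-into : ∀ b → Enumeration (λ a → Arc a b) z
  arcs-into b = record
    { element   = λ i → shifted (- + arc-length i) b
    ; injective = λ {i} {j} →
        arc-length-injective ∘ neg-cancel ∘ shifted-injective b (- + arc-length i) (- + arc-length j)
    ; sound     = λ i → i , subst (λ d → Shift d (shifted (- + arc-length i) b) b) (neg-involutive (+ arc-length i))
                                  (shift-flip (shift-shifted (- + arc-length i) b))
    ; complete  = λ (i , a↝b) → i , shift⇒≡shifted (shift-flip a↝b)
    }

  neighbour : Vertex → Fin r → Vertex
  neighbour (point y x) m = line (residue (⟦ y ⟧ - ⟦ m ⟧ * ⟦ x ⟧)) m
  neighbour (line b m)  x = point (residue (⟦ m ⟧ * ⟦ x ⟧ + ⟦ b ⟧)) x

  edge-neighbour : ∀ a i → Edge a (neighbour a i)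
  edge-neighbour (point y x) m = begin
    ⟦ y ⟧                                                ≡⟨ identity ⟦ y ⟧ (⟦ m ⟧ * ⟦ x ⟧) ⟩
    ⟦ m ⟧ * ⟦ x ⟧ + (⟦ y ⟧ - ⟦ m ⟧ * ⟦ x ⟧)              ≈⟨ +-congˡ (⟦ m ⟧ * ⟦ x ⟧) (residue-≈ _) ⟨
    ⟦ m ⟧ * ⟦ x ⟧ + ⟦ residue (⟦ y ⟧ - ⟦ m ⟧ * ⟦ x ⟧) ⟧  ∎
    where identity : ∀ y t → y ≡ t + (y - t)
          identity = solve-∀
  edge-neighbour (line b m) x = residue-≈ _

  edge⇒≡neighbour : ∀ {a b} → Edge a b → b ≡ neighbour a (column b)
  edge⇒≡neighbour {point y x} {line b m} y≈ = cong (λ b → line b m) (residue-unique (begin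
    ⟦ b ⟧                                 ≡⟨ identity ⟦ b ⟧ (⟦ m ⟧ * ⟦ x ⟧) ⟩
    (⟦ m ⟧ * ⟦ x ⟧ + ⟦ b ⟧) - ⟦ m ⟧ * ⟦ x ⟧  ≈⟨ +-congʳ (- (⟦ m ⟧ * ⟦ x ⟧)) y≈ ⟨
    ⟦ y ⟧ - ⟦ m ⟧ * ⟦ x ⟧                   ∎))
    where identity : ∀ b t → b ≡ (t + b) - t
          identity = solve-∀
  edge⇒≡neighbour {line b m} {point y x} y≈ = cong (λ y → point y x) (residue-unique y≈)

  edges-at : ∀ a → Enumeration (Edge a) r
  edges-at a = record
    { element   = neighbour a
    ; injective = injective a
    ; sound     = edge-neighbour a
    ; complete  = λ ab → _ , edge⇒≡neighbour ab
    }
    where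
    injective : ∀ a {i j} → neighbour a i ≡ neighbour a j → i ≡ j
    injective (point _ _) = cong column
    injective (line _ _)  = cong column

  open Realisation vertices edge? arc? edge-sym edge-irrefl arc-irrefl edge⇒¬arc public

  shift-column : ∀ {d a b} → Shift d a b → column a ≡ column b
  shift-column (shift _) = refl

  edge-column-injective : ∀ {a b c} → Edge a b → Edge a c → column b ≡ column c → b ≡ c
  edge-column-injective {a} ab ac b≡c =
    trans (edge⇒≡neighbour ab) (trans (cong (neighbour a) b≡c) (sym (edge⇒≡neighbour ac)))

  shift-across-edges : ∀ {d a b c e} → Edge a b → Edge c e → Shift d a c → column b ≡ column e → Shift d b e
  shift-across-edges {d} {point y x} {line b m} {point y′ .x} {line b′ .m} y≈ y′≈ (shift y′≈y+d) refl =
    shift (+-cancelˡ (⟦ m ⟧ * ⟦ x ⟧) (begin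
      ⟦ m ⟧ * ⟦ x ⟧ + ⟦ b′ ⟧         ≈⟨ y′≈ ⟨
      ⟦ y′ ⟧                         ≈⟨ y′≈y+d ⟩
      ⟦ y ⟧ + d                      ≈⟨ +-congʳ d y≈ ⟩
      (⟦ m ⟧ * ⟦ x ⟧ + ⟦ b ⟧) + d    ≡⟨ +-assoc (⟦ m ⟧ * ⟦ x ⟧) ⟦ b ⟧ d ⟩
      ⟦ m ⟧ * ⟦ x ⟧ + (⟦ b ⟧ + d)    ∎))
  shift-across-edges {d} {line b m} {point y x} {line b′ .m} {point y′ .x} y≈ y′≈ (shift b′≈b+d) refl =
    shift (begin
      ⟦ y′ ⟧                         ≈⟨ y′≈ ⟩
      ⟦ m ⟧ * ⟦ x ⟧ + ⟦ b′ ⟧         ≈⟨ +-congˡ (⟦ m ⟧ * ⟦ x ⟧) b′≈b+d ⟩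
      ⟦ m ⟧ * ⟦ x ⟧ + (⟦ b ⟧ + d)    ≡⟨ +-assoc (⟦ m ⟧ * ⟦ x ⟧) ⟦ b ⟧ d ⟨
      (⟦ m ⟧ * ⟦ x ⟧ + ⟦ b ⟧) + d    ≈⟨ +-congʳ d y≈ ⟨
      ⟦ y ⟧ + d                      ∎)

  column-≈⇒≡ : ∀ {c c′ : Fin r} → ⟦ c ⟧ ≈ ⟦ c′ ⟧ → c ≡ c′
  column-≈⇒≡ {c} {c′} c≈c′ =
    toℕ-injective (small-≈⇒≡ (ℕ.<-≤-trans (toℕ<n c) r≤p) (ℕ.<-≤-trans (toℕ<n c′) r≤p) c≈c′)

  quadrangle-through-point : ∀ {y x b c d} → Edge (point y x) b → Edge b c → Edge c d → Edge d (point y x) →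
    point y x ≡ c ⊎ b ≡ d
  quadrangle-through-point {y} {x} {line b m} {point _ _} {line _ _} ab bc cd da =
    Sum.map (λ x≈x′ → edge-column-injective {line b m} ab bc (column-≈⇒≡ x≈x′))
            (λ m≈m′ → edge-column-injective {point y x} ab da (column-≈⇒≡ m≈m′))
            (Sum.swap (incidence-quadrangle p-prime ab bc da cd))

  edge-quadrangle-degenerate : ∀ {a b c d} → Edge a b → Edge b c → Edge c d → Edge d a → a ≡ c ⊎ b ≡ d
  edge-quadrangle-degenerate {point _ _} ab bc cd da = quadrangle-through-point ab bc cd da
  edge-quadrangle-degenerate {line _ _} {point _ _} ab bc cd da with quadrangle-through-point bc cd da ab
  ... | inj₁ b≡d = inj₂ b≡d
  ... | inj₂ c≡a = inj₁ (sym c≡a)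

  record Drift (k : ℕ) (a b : Vertex) : Set where
    constructor drift
    field
      distance : ℕ
      positive : 0 < distance
      bounded  : distance ≤ k ℕ.* z
      shifted-by : Shift (+ distance) a b

  arc⇒drift : ∀ {a b} → Arc a b → Drift 1 a b
  arc⇒drift (i , a↝b) = drift (arc-length i) (s≤s z≤n) (ℕ.≤-trans (toℕ<n i) (ℕ.m≤m+n z 0)) a↝b

  drift-trans : ∀ {k l a b c} → Drift k a b → Drift l b c → Drift (k ℕ.+ l) a c
  drift-trans {k} {l} (drift m 0<m m≤kz a↝b) (drift n _ n≤lz b↝c) =
    drift (m ℕ.+ n) (ℕ.<-≤-trans 0<m (ℕ.m≤m+n m n))
      (subst (m ℕ.+ n ≤_) (sym (ℕ.*-distribʳ-+ z k l)) (ℕ.+-mono-≤ m≤kz n≤lz)) (shift-trans a↝b b↝c)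

  drift-irrefl : ∀ {k a} {k≤4 : True (k ℕ.≤? 4)} → ¬ Drift k a a
  drift-irrefl {k} {k≤4 = k≤4} (drift n 0<n n≤kz a↝a) =
    shift-irrefl 0<n (ℕ.≤-<-trans n≤kz (ℕ.≤-<-trans (ℕ.*-monoˡ-≤ z (toWitness k≤4)) 4z<p)) a↝a

  drift-column : ∀ {k a b} → Drift k a b → column a ≡ column b
  drift-column (drift _ _ _ a↝b) = shift-column a↝b

  drift-across-edges : ∀ {k a b c d} → Edge a b → Edge c d → Drift k a c → column b ≡ column d → Drift k b d
  drift-across-edges ab cd (drift n 0<n n≤kz a↝c) b≡d = drift n 0<n n≤kz (shift-across-edges ab cd a↝c b≡d)

  neighbours-not-drifted : ∀ {k a b c} {k≤4 : True (k ℕ.≤? 4)} → Edge a b → Edge a c → ¬ Drift k b c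
  neighbours-not-drifted {k≤4 = k≤4} ab ac b↝c with edge-column-injective ab ac (drift-column b↝c)
  ... | refl = drift-irrefl {k≤4 = k≤4} b↝c

  infixr 5 _∷_
  data Walk : Vertex → Vertex → Set where
    []  : ∀ {a} → Walk a a
    _∷_ : ∀ {a b c} → Link a b → Walk b c → Walk a c

  crosses : ∀ {a b} → Link a b → Bool
  crosses (inj₁ _) = true
  crosses (inj₂ _) = false

  crossings : ∀ {a b} → Walk a b → Bool
  crossings []      = false
  crossings (l ∷ w) = crosses l xor crossings w

  side-link : ∀ {a b} (l : Link a b) → side a ≡ crosses l xor side b
  side-link {point _ _} {line _ _} (inj₁ _) = refl
  side-link {line _ _} {point _ _} (inj₁ _) = refl
  side-link (inj₂ (_ , shift _)) = refl

  side-walk : ∀ {a b} (w : Walk a b) → side a ≡ crossings w xor side b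
  side-walk [] = refl
  side-walk {b = b} (l ∷ w) =
    trans (side-link l) (trans (cong (crosses l xor_) (side-walk w)) (sym (xor-assoc (crosses l) (crossings w) (side b))))

  closed-walk-crossings : ∀ {a} (w : Walk a a) → crossings w ≡ false
  closed-walk-crossings {a} w = fixed (crossings w) (side a) (side-walk w)
    where
    fixed : ∀ c s → s ≡ c xor s → c ≡ false
    fixed false _     _  = refl
    fixed true  false ()
    fixed true  true  ()

  no-digon : ∀ {a b} → Arc a b → ¬ Link b a
  no-digon ab (inj₁ ba) = edge⇒¬arc (edge-sym ba) ab
  no-digon ab (inj₂ ba) = drift-irrefl (drift-trans (arc⇒drift ab) (arc⇒drift ba))

  -- In no-triangle and quadrangle-degenerate the absurd clauses are the walks with an odd number of edges.
  no-triangle : ∀ {a b c} → Link a b → Link b c → ¬ Link c a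
  no-triangle ab bc ca with closed-walk-crossings (ab ∷ bc ∷ ca ∷ [])
  no-triangle (inj₂ ab) (inj₂ bc) (inj₂ ca) | _ =
    drift-irrefl (drift-trans (drift-trans (arc⇒drift ab) (arc⇒drift bc)) (arc⇒drift ca))
  no-triangle (inj₂ ab) (inj₁ bc) (inj₁ ca) | _ = neighbours-not-drifted ca (edge-sym bc) (arc⇒drift ab)
  no-triangle (inj₁ ab) (inj₂ bc) (inj₁ ca) | _ = neighbours-not-drifted ab (edge-sym ca) (arc⇒drift bc)
  no-triangle (inj₁ ab) (inj₁ bc) (inj₂ ca) | _ = neighbours-not-drifted bc (edge-sym ab) (arc⇒drift ca)
  no-triangle (inj₁ _) (inj₁ _) (inj₁ _) | ()
  no-triangle (inj₁ _) (inj₂ _) (inj₂ _) | ()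
  no-triangle (inj₂ _) (inj₁ _) (inj₂ _) | ()
  no-triangle (inj₂ _) (inj₂ _) (inj₁ _) | ()

  quadrangle-degenerate : ∀ {a b c d} → Link a b → Link b c → Link c d → Link d a → a ≡ c ⊎ b ≡ d
  quadrangle-degenerate ab bc cd da with closed-walk-crossings (ab ∷ bc ∷ cd ∷ da ∷ [])
  quadrangle-degenerate (inj₂ ab) (inj₂ bc) (inj₂ cd) (inj₂ da) | _ = ⊥-elim (drift-irrefl
    (drift-trans (drift-trans (drift-trans (arc⇒drift ab) (arc⇒drift bc)) (arc⇒drift cd)) (arc⇒drift da)))
  quadrangle-degenerate (inj₁ ab) (inj₁ bc) (inj₁ cd) (inj₁ da) | _ = edge-quadrangle-degenerate ab bc cd da
  quadrangle-degenerate (inj₁ ab) (inj₁ bc) (inj₂ cd) (inj₂ da) | _ =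
    ⊥-elim (neighbours-not-drifted bc (edge-sym ab) (drift-trans (arc⇒drift cd) (arc⇒drift da)))
  quadrangle-degenerate (inj₂ ab) (inj₁ bc) (inj₁ cd) (inj₂ da) | _ =
    ⊥-elim (neighbours-not-drifted cd (edge-sym bc) (drift-trans (arc⇒drift da) (arc⇒drift ab)))
  quadrangle-degenerate (inj₂ ab) (inj₂ bc) (inj₁ cd) (inj₁ da) | _ =
    ⊥-elim (neighbours-not-drifted da (edge-sym cd) (drift-trans (arc⇒drift ab) (arc⇒drift bc)))
  quadrangle-degenerate (inj₁ ab) (inj₂ bc) (inj₂ cd) (inj₁ da) | _ =
    ⊥-elim (neighbours-not-drifted ab (edge-sym da) (drift-trans (arc⇒drift bc) (arc⇒drift cd)))
  quadrangle-degenerate (inj₁ ab) (inj₂ bc) (inj₁ cd) (inj₂ da) | _ = ⊥-elim (drift-irrefl (drift-trans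
    (drift-across-edges (edge-sym cd) ab (arc⇒drift da) (sym (drift-column (arc⇒drift bc)))) (arc⇒drift bc)))
  quadrangle-degenerate (inj₂ ab) (inj₁ bc) (inj₂ cd) (inj₁ da) | _ = ⊥-elim (drift-irrefl (drift-trans
    (arc⇒drift cd) (drift-across-edges (edge-sym da) bc (arc⇒drift ab) (sym (drift-column (arc⇒drift cd))))))
  quadrangle-degenerate (inj₁ _) (inj₁ _) (inj₁ _) (inj₂ _) | ()
  quadrangle-degenerate (inj₁ _) (inj₁ _) (inj₂ _) (inj₁ _) | ()
  quadrangle-degenerate (inj₁ _) (inj₂ _) (inj₁ _) (inj₁ _) | ()
  quadrangle-degenerate (inj₂ _) (inj₁ _) (inj₁ _) (inj₁ _) | ()
  quadrangle-degenerate (inj₁ _) (inj₂ _) (inj₂ _) (inj₂ _) | ()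
  quadrangle-degenerate (inj₂ _) (inj₁ _) (inj₂ _) (inj₂ _) | ()
  quadrangle-degenerate (inj₂ _) (inj₂ _) (inj₁ _) (inj₂ _) | ()
  quadrangle-degenerate (inj₂ _) (inj₂ _) (inj₂ _) (inj₁ _) | ()

  module Pentagon (z≥1 : 1 ≤ z) (p≤5z : p ≤ 5 ℕ.* z) (c : Fin r) where

    instance
      z≢0 : NonZero z
      z≢0 = ℕ.>-nonZero z≥1

    height<p : ∀ i → i % 5 ℕ.* z < p
    height<p i = ℕ.≤-<-trans (ℕ.*-monoˡ-≤ z (ℕ.s≤s⁻¹ (m%n<n i 5))) 4z<p

    pentagon : ℕ → Vertex
    pentagon i = point (fromℕ< (height<p i)) c

    arc-of-length : ∀ {d a b} → 0 < d → d ≤ z → Shift (+ d) a b → Arc a b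
    arc-of-length {suc d} {a} {b} _ d<z a↝b =
      fromℕ< d<z , subst (λ n → Shift (+ suc n) a b) (sym (toℕ-fromℕ< d<z)) a↝b

    height-step : ∀ i → suc i < 5 → toℕ (fromℕ< (height<p i)) ℕ.+ z ≡ toℕ (fromℕ< (height<p (suc i)))
    height-step i i+1<5
      rewrite toℕ-fromℕ< (height<p i) | toℕ-fromℕ< (height<p (suc i))
            | m<n⇒m%n≡m (ℕ.<-trans (ℕ.n<1+n i) i+1<5) | m<n⇒m%n≡m i+1<5 = ℕ.+-comm (i ℕ.* z) z

    shift-of-sum : ∀ {s h h′ c d} → toℕ h ℕ.+ d ≡ toℕ h′ → Shift (+ d) (s , h , c) (s , h′ , c)
    shift-of-sum {h = h} {d = d} h+d≡h′ = shift (≈-reflexive (trans (cong +_ (sym h+d≡h′)) (pos-+ (toℕ h) d)))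

    pentagon-step : ∀ i → suc i < 5 → Arc (pentagon i) (pentagon (suc i))
    pentagon-step i i+1<5 = arc-of-length z≥1 ℕ.≤-refl (shift-of-sum (height-step i i+1<5))

    pentagon-wrap : Arc (pentagon 4) (pentagon 5)
    pentagon-wrap = arc-of-length (ℕ.m<n⇒0<n∸m 4z<p) p∸4z≤z (shift (begin
      ⟦ fromℕ< (height<p 5) ⟧                      ≡⟨ cong +_ (toℕ-fromℕ< (height<p 5)) ⟩
      0ℤ                                           ≈⟨ p≈0 ⟨
      + p                                          ≡⟨ cong +_ (ℕ.m+[n∸m]≡n (ℕ.<⇒≤ 4z<p)) ⟨
      + (4 ℕ.* z ℕ.+ (p ℕ.∸ 4 ℕ.* z))              ≡⟨ pos-+ (4 ℕ.* z) _ ⟩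
      + (4 ℕ.* z) + + (p ℕ.∸ 4 ℕ.* z)              ≡⟨ cong (λ h → + h + + (p ℕ.∸ 4 ℕ.* z)) (toℕ-fromℕ< (height<p 4)) ⟨
      ⟦ fromℕ< (height<p 4) ⟧ + + (p ℕ.∸ 4 ℕ.* z)  ∎))
      where
      p∸4z≤z : p ℕ.∸ 4 ℕ.* z ≤ z
      p∸4z≤z = subst (p ℕ.∸ 4 ℕ.* z ≤_) (ℕ.m+n∸n≡m z (4 ℕ.* z)) (ℕ.∸-monoˡ-≤ (4 ℕ.* z) p≤5z)

    pentagon-arc : ∀ i → i < 5 → Arc (pentagon i) (pentagon (suc i))
    pentagon-arc 0 _ = pentagon-step 0 (s≤s (s≤s z≤n))
    pentagon-arc 1 _ = pentagon-step 1 (s≤s (s≤s (s≤s z≤n)))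
    pentagon-arc 2 _ = pentagon-step 2 (s≤s (s≤s (s≤s (s≤s z≤n))))
    pentagon-arc 3 _ = pentagon-step 3 (s≤s (s≤s (s≤s (s≤s (s≤s z≤n)))))
    pentagon-arc 4 _ = pentagon-wrap
    pentagon-arc (suc (suc (suc (suc (suc _))))) (s≤s (s≤s (s≤s (s≤s (s≤s ())))))

    pentagon-injective : ∀ {i j} → i < 5 → j < 5 → pentagon i ≡ pentagon j → i ≡ j
    pentagon-injective {i} {j} i<5 j<5 eq =
      trans (sym (m<n⇒m%n≡m i<5)) (trans (ℕ.*-cancelʳ-≡ (i % 5) (j % 5) z heights) (m<n⇒m%n≡m j<5))
      where
      heights : i % 5 ℕ.* z ≡ j % 5 ℕ.* z
      heights = trans (sym (toℕ-fromℕ< (height<p i))) (trans (cong (toℕ ∘ proj₁ ∘ proj₂) eq) (toℕ-fromℕ< (height<p j)))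

    pentagon-cycle : Cycle graph 5
    pentagon-cycle = arc-cycle pentagon (s≤s (s≤s z≤n)) refl pentagon-arc (λ _ _ → pentagon-injective)

open import Data.Nat using (_+_; _*_)

mainTheorem7 : (z p : ℕ) → 1 ≤ z → z ≢ 2 → SmallestPrimeIn (4 * z + 1) (5 * z) p →
    (r : ℕ) → 1 ≤ r → r ≤ p → CageOrder≤ z r 5 (2 * p * r)
mainTheorem7 z p z≥1 _ (p-prime , 4z+1≤p , p≤5z , _) r r≥1 r≤p =
  2 * p * r , ℕ.≤-refl , graph ,
  is-mixed-graph arcs-into arcs-out-of edges-at (pentagon-cycle , λ _ → cycle-length≥5 no-digon no-triangle quadrangle-degenerate)
  where
  4z<p : 4 * z < p
  4z<p = subst (_≤ p) (ℕ.+-comm (4 * z) 1) 4z+1≤p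
  open PartialPlane p z r p-prime 4z<p r≤p
  open Pentagon z≥1 p≤5z (fromℕ< r≥1)
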